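{- Let $\sigma^{*\mathrm{inv}}$ be the Dirichlet inverse of $\sigma^*$ over $\mathbb{F}_2[x]$, and let $P\in\mathbb{F}_2[x]$ be irreducible. Then $\sigma^{*\mathrm{inv}}(P^{2r})=0$ for every integer $r\ge1$, and $\sigma^{*\mathrm{inv}}(P^{2r+1})=P^{r}(1+P)$ for every integer $r\ge0$.
   Context: A divisor $D$ of $A\in\mathbb{F}_2[x]$ is unitary if $\gcd(D,A/D)=1$, and $\sigma^*(A)$ is the sum of all unitary divisors of $A$. A function $f:\mathbb{F}_2[x]\setminus\{0\}\to\mathbb{F}_2[x]$ is multiplicative if $f(AB)=f(A)f(B)$ whenever $\gcd(A,B)=1$; the Dirichlet convolution is $(f*g)(A)=\sum_{D\mid A}f(D)g(A/D)$ over all divisors $D$ of $A$; $\delta(1)=1$, $\delta(A)=0$ for $A\ne1$; the Dirichlet inverse $f^{\mathrm{inv}}$ is the unique multiplicative function with $f*f^{\mathrm{inv}}=\delta$. -}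

module Defs where

open import Data.Bool using (Bool; true; false; not; _∧_; _∨_; if_then_else_)
open import Data.Bool using () renaming (_xor_ to _⊕_)
open import Data.Nat using (ℕ; zero; suc)
open import Data.List using (List; []; _∷_; concatMap; foldr)
open import Data.Bool.ListAction using (all; any)
open import Data.Product using (∃; _×_)
open import Data.Sum using (_⊎_)
open import Relation.Binary.PropositionalEquality using (_≡_; _≢_)

-- Polynomials over F₂, in canonical form (so _≡_ is polynomial equality).
-- A nonzero polynomial is either 1, or q·x + b with q nonzero, b ∈ F₂.

data Poly⁺ : Set where
  1⁺   : Poly⁺
  _x+_ : Poly⁺ → Bool → Poly⁺

data Poly : Set where
  0ₚ  : Poly
  ⟨_⟩ : Poly⁺ → Poly

1ₚ : Poly
1ₚ = ⟨ 1⁺ ⟩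

cons : Bool → Poly → Poly
cons false 0ₚ    = 0ₚ
cons true  0ₚ    = ⟨ 1⁺ ⟩
cons b     ⟨ q ⟩ = ⟨ q x+ b ⟩

add⁺ : Poly⁺ → Poly⁺ → Poly
add⁺ 1⁺       1⁺       = 0ₚ
add⁺ 1⁺       (q x+ b) = ⟨ q x+ not b ⟩
add⁺ (p x+ a) 1⁺       = ⟨ p x+ not a ⟩
add⁺ (p x+ a) (q x+ b) = cons (a ⊕ b) (add⁺ p q)

infixl 6 _+_
infixl 7 _*_
infixr 8 _^_
infix 4 _==_

_+_ : Poly → Poly → Poly
0ₚ    + q     = q
⟨ p ⟩ + 0ₚ    = ⟨ p ⟩
⟨ p ⟩ + ⟨ q ⟩ = add⁺ p q

mul⁺ : Poly⁺ → Poly → Poly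
mul⁺ 1⁺       q = q
mul⁺ (p x+ b) q = cons false (mul⁺ p q) + (if b then q else 0ₚ)

_*_ : Poly → Poly → Poly
0ₚ    * q = 0ₚ
⟨ p ⟩ * q = mul⁺ p q

_^_ : Poly → ℕ → Poly
P ^ zero  = 1ₚ
P ^ suc n = P * P ^ n

eq⁺ : Poly⁺ → Poly⁺ → Bool
eq⁺ 1⁺       1⁺       = true
eq⁺ (p x+ a) (q x+ b) = eq⁺ p q ∧ not (a ⊕ b)
eq⁺ _        _        = false

_==_ : Poly → Poly → Bool
0ₚ    == 0ₚ    = true
⟨ p ⟩ == ⟨ q ⟩ = eq⁺ p q
_     == _     = false

-- Finite enumeration: all polynomials of degree < n (each exactly once),
-- where 0 is included (degree -∞).

allLen : ℕ → List Poly
allLen zero    = 0ₚ ∷ []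
allLen (suc n) = concatMap (λ p → cons false p ∷ cons true p ∷ []) (allLen n)

-- size A = deg A + 1 for A ≠ 0, size 0 = 0.
-- Every divisor / cofactor of a nonzero A has degree < size A.
size⁺ : Poly⁺ → ℕ
size⁺ 1⁺       = 1
size⁺ (p x+ _) = suc (size⁺ p)

size : Poly → ℕ
size 0ₚ    = 0
size ⟨ p ⟩ = size⁺ p

cands : Poly → List Poly
cands A = allLen (size A)

sumP : List Poly → Poly
sumP = foldr _+_ 0ₚ

_∣_ : Poly → Poly → Set
D ∣ A = ∃ λ Q → D * Q ≡ A

-- gcd(A,B) = 1 : the only common divisor is the unit 1 (the only unit of F₂[x])
Coprime : Poly → Poly → Set
Coprime A B = ∀ C → C ∣ A → C ∣ B → C ≡ 1ₚ

Irreducible : Poly → Set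
Irreducible P = P ≢ 0ₚ × P ≢ 1ₚ × (∀ D E → D * E ≡ P → D ≡ 1ₚ ⊎ E ≡ 1ₚ)

-- Boolean (bounded-search) versions, used to compute finite sums.
-- For A ≠ 0, any Q with C * Q ≡ A has degree ≤ deg A, so the search is exact.
divides? : Poly → Poly → Bool
divides? C A = any (λ Q → (C * Q) == A) (cands A)

-- For D ≠ 0, every common divisor C of D has degree ≤ deg D.
coprime? : Poly → Poly → Bool
coprime? D E = all (λ C → not (divides? C D ∧ divides? C E) ∨ (C == 1ₚ)) (cands D)

-- Arithmetic functions F₂[x]∖{0} → F₂[x]  (values at 0 are irrelevant)

Multiplicative : (Poly → Poly) → Set
Multiplicative f = ∀ A B → A ≢ 0ₚ → B ≢ 0ₚ → Coprime A B → f (A * B) ≡ f A * f B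

conv : (Poly → Poly) → (Poly → Poly) → Poly → Poly
conv f g A = sumP (concatMap (λ D → concatMap (λ E →
               if (D * E) == A then (f D * g E) ∷ [] else []) (cands A)) (cands A))

δ : Poly → Poly
δ A = if A == 1ₚ then 1ₚ else 0ₚ

σ* : Poly → Poly
σ* A = sumP (concatMap (λ D → concatMap (λ E →
         if ((D * E) == A) ∧ coprime? D E then D ∷ [] else []) (cands A)) (cands A))

-- On powers of an irreducible P the divisors are exactly the P ^ i, and the unitary divisors
-- of P ^ k (k ≥ 1) are 1 and P ^ k, so σ*(P ^ k) = 1 + P ^ k.  Restricted to powers of P, the
-- identity σ* ∗ g = δ therefore says that Σ g(P ^ n) tⁿ is the inverse of the power series
--   S(t) = 1 + Σ_{k≥1} (1 + P ^ k) tᵏ = (1 + P t²) / ((1 + t)(1 + P t))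
-- over F₂[x].  The inverse (1 + t)(1 + P t) / (1 + P t²) has coefficient 0 at t^{2r} (r ≥ 1)
-- and P ^ r (1 + P) at t^{2r+1}; it is verified coefficientwise, and a series with constant
-- term 1 has only one inverse.

module Submission where

open import Defs
open import Data.Nat using (ℕ; _≤_) renaming (_+_ to _+ℕ_; _*_ to _*ℕ_)
open import Data.Product using (_×_)
open import Relation.Binary.PropositionalEquality using (_≡_; _≢_)

open import Algebra.Bundles using (CommutativeRing; CommutativeSemigroup)
import Algebra.Properties.CommutativeSemigroup as CommutativeSemigroupProperties
open import Algebra.Structures {A = Poly} _≡_ using (IsCommutativeRing)
open import Data.Bool using (Bool; true; false; not; _∧_; _∨_; if_then_else_; _xor_)
open import Data.Bool.ListAction using (all; any)
open import Data.Bool.Properties using (xor-comm; xor-assoc; xor-same; ∧-zeroʳ; ∨-zeroʳ)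
open import Data.Empty using (⊥-elim)
open import Data.List using (List; []; _∷_; _++_; map; concatMap)
open import Data.List.Membership.Propositional using (_∈_; lose)
open import Data.List.Membership.Propositional.Properties using (∈-concatMap⁺)
open import Data.List.Relation.Unary.Any using (here; there)
open import Data.Maybe using (Maybe; just; nothing)
open import Data.Nat using (zero; suc; pred; _∸_; _<_; z≤n; s≤s)
open import Data.Nat.Induction using (<-rec)
import Data.Nat.Properties as ℕ
open import Data.Product using (Σ; _,_; proj₁; proj₂)
open import Data.Sum using (_⊎_; inj₁; inj₂)
open import Function using (_∘_; case_of_)
open import Relation.Binary.Definitions using (tri<; tri≈; tri>)
open import Relation.Binary.PropositionalEquality
open import Relation.Nullary using (Dec; yes; no)
open import Tactic.RingSolver.Core.AlmostCommutativeRing using (fromCommutativeRing)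

open ≡-Reasoning

-- Ring structure of F₂[x]

cons-⟨⟩ : ∀ b q → cons b ⟨ q ⟩ ≡ ⟨ q x+ b ⟩
cons-⟨⟩ false q = refl
cons-⟨⟩ true  q = refl

coeff₀ : Poly → Bool
coeff₀ 0ₚ         = false
coeff₀ ⟨ 1⁺ ⟩     = true
coeff₀ ⟨ p x+ b ⟩ = b

divX : Poly → Poly
divX 0ₚ         = 0ₚ
divX ⟨ 1⁺ ⟩     = 0ₚ
divX ⟨ p x+ b ⟩ = ⟨ p ⟩

cons-coeff₀-divX : ∀ p → cons (coeff₀ p) (divX p) ≡ p
cons-coeff₀-divX 0ₚ         = refl
cons-coeff₀-divX ⟨ 1⁺ ⟩     = refl
cons-coeff₀-divX ⟨ p x+ b ⟩ = cons-⟨⟩ b p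

coeff₀-cons : ∀ b p → coeff₀ (cons b p) ≡ b
coeff₀-cons false 0ₚ    = refl
coeff₀-cons true  0ₚ    = refl
coeff₀-cons false ⟨ _ ⟩ = refl
coeff₀-cons true  ⟨ _ ⟩ = refl

divX-cons : ∀ b p → divX (cons b p) ≡ p
divX-cons false 0ₚ    = refl
divX-cons true  0ₚ    = refl
divX-cons false ⟨ _ ⟩ = refl
divX-cons true  ⟨ _ ⟩ = refl

Poly-ind : (Q : Poly → Set) → Q 0ₚ → (∀ b p → Q p → Q (cons b p)) → ∀ p → Q p
Poly-ind Q q₀ step 0ₚ    = q₀
Poly-ind Q q₀ step ⟨ p ⟩ = go p
  where
  go : ∀ p → Q ⟨ p ⟩
  go 1⁺       = step true 0ₚ q₀
  go (p x+ b) = subst Q (cons-⟨⟩ b p) (step b ⟨ p ⟩ (go p))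

by-cons : {Q : Poly → Set} → (∀ b q → Q (cons b q)) → ∀ p → Q p
by-cons {Q} f p = subst Q (cons-coeff₀-divX p) (f (coeff₀ p) (divX p))

+-identityˡ : ∀ p → 0ₚ + p ≡ p
+-identityˡ p = refl

+-identityʳ : ∀ p → p + 0ₚ ≡ p
+-identityʳ 0ₚ    = refl
+-identityʳ ⟨ _ ⟩ = refl

+-cons : ∀ a b p q → cons a p + cons b q ≡ cons (a xor b) (p + q)
+-cons false false 0ₚ    0ₚ    = refl
+-cons false false 0ₚ    ⟨ _ ⟩ = refl
+-cons false false ⟨ _ ⟩ 0ₚ    = refl
+-cons false false ⟨ _ ⟩ ⟨ _ ⟩ = refl
+-cons false true  0ₚ    0ₚ    = refl
+-cons false true  0ₚ    ⟨ _ ⟩ = refl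
+-cons false true  ⟨ _ ⟩ 0ₚ    = refl
+-cons false true  ⟨ _ ⟩ ⟨ _ ⟩ = refl
+-cons true  false 0ₚ    0ₚ    = refl
+-cons true  false 0ₚ    ⟨ _ ⟩ = refl
+-cons true  false ⟨ _ ⟩ 0ₚ    = refl
+-cons true  false ⟨ _ ⟩ ⟨ _ ⟩ = refl
+-cons true  true  0ₚ    0ₚ    = refl
+-cons true  true  0ₚ    ⟨ _ ⟩ = refl
+-cons true  true  ⟨ _ ⟩ 0ₚ    = refl
+-cons true  true  ⟨ _ ⟩ ⟨ _ ⟩ = refl

+-comm : ∀ p q → p + q ≡ q + p
+-comm = Poly-ind _ (λ q → sym (+-identityʳ q)) λ a p ih → by-cons λ b q →
  trans (+-cons a b p q) (trans (cong₂ cons (xor-comm a b) (ih q)) (sym (+-cons b a q p)))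

+-assoc : ∀ p q r → (p + q) + r ≡ p + (q + r)
+-assoc = Poly-ind _ (λ _ _ → refl) λ a p ih → by-cons λ b q → by-cons λ c r → begin
    (cons a p + cons b q) + cons c r     ≡⟨ cong (_+ cons c r) (+-cons a b p q) ⟩
    cons (a xor b) (p + q) + cons c r    ≡⟨ +-cons (a xor b) c (p + q) r ⟩
    cons ((a xor b) xor c) (p + q + r)   ≡⟨ cong₂ cons (xor-assoc a b c) (ih q r) ⟩
    cons (a xor (b xor c)) (p + (q + r)) ≡⟨ sym (+-cons a (b xor c) p (q + r)) ⟩
    cons a p + cons (b xor c) (q + r)    ≡⟨ cong (cons a p +_) (sym (+-cons b c q r)) ⟩
    cons a p + (cons b q + cons c r)     ∎

+-self : ∀ p → p + p ≡ 0ₚ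
+-self = Poly-ind _ refl λ a p ih → trans (+-cons a a p p) (cong₂ cons (xor-same a) ih)

+-commutativeSemigroup : CommutativeSemigroup _ _
+-commutativeSemigroup = record
  { isCommutativeSemigroup = record
    { isSemigroup = record
      { isMagma = record { isEquivalence = isEquivalence ; ∙-cong = cong₂ _+_ }
      ; assoc   = +-assoc }
    ; comm = +-comm } }

open CommutativeSemigroupProperties +-commutativeSemigroup using (interchange)

shift-+ : ∀ p q → cons false (p + q) ≡ cons false p + cons false q
shift-+ p q = sym (+-cons false false p q)

infixl 7 _·_
_·_ : Bool → Poly → Poly
b · q = if b then q else 0ₚ

·-zeroʳ : ∀ b → b · 0ₚ ≡ 0ₚ
·-zeroʳ false = refl
·-zeroʳ true  = refl

·-identityʳ : ∀ b → b · 1ₚ ≡ cons b 0ₚ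
·-identityʳ false = refl
·-identityʳ true  = refl

·-xor : ∀ a b q → (a xor b) · q ≡ a · q + b · q
·-xor false b     q = refl
·-xor true  false q = sym (+-identityʳ q)
·-xor true  true  q = sym (+-self q)

*-cons : ∀ b p q → cons b p * q ≡ cons false (p * q) + b · q
*-cons false 0ₚ    q = refl
*-cons true  0ₚ    q = refl
*-cons false ⟨ _ ⟩ q = refl
*-cons true  ⟨ _ ⟩ q = refl

*-zeroʳ : ∀ p → p * 0ₚ ≡ 0ₚ
*-zeroʳ = Poly-ind _ refl λ a p ih →
  trans (*-cons a p 0ₚ) (cong₂ (λ u v → cons false u + v) ih (·-zeroʳ a))

*-identityˡ : ∀ p → 1ₚ * p ≡ p
*-identityˡ p = refl

*-identityʳ : ∀ p → p * 1ₚ ≡ p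
*-identityʳ = Poly-ind _ refl λ a p ih → begin
  cons a p * 1ₚ                     ≡⟨ *-cons a p 1ₚ ⟩
  cons false (p * 1ₚ) + a · 1ₚ      ≡⟨ cong₂ (λ u v → cons false u + v) ih (·-identityʳ a) ⟩
  cons false p + cons a 0ₚ          ≡⟨ +-cons false a p 0ₚ ⟩
  cons a (p + 0ₚ)                   ≡⟨ cong (cons a) (+-identityʳ p) ⟩
  cons a p                          ∎

*-distribʳ : ∀ x y z → (x + y) * z ≡ x * z + y * z
*-distribʳ = Poly-ind _ (λ _ _ → refl) λ a p ih → by-cons λ b q z → begin
  (cons a p + cons b q) * z                                ≡⟨ cong (_* z) (+-cons a b p q) ⟩
  cons (a xor b) (p + q) * z                               ≡⟨ *-cons (a xor b) (p + q) z ⟩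
  cons false ((p + q) * z) + (a xor b) · z                 ≡⟨ cong₂ (λ u v → cons false u + v) (ih q z) (·-xor a b z) ⟩
  cons false (p * z + q * z) + (a · z + b · z)             ≡⟨ cong (_+ (a · z + b · z)) (shift-+ (p * z) (q * z)) ⟩
  (cons false (p * z) + cons false (q * z)) + (a · z + b · z)
    ≡⟨ interchange (cons false (p * z)) (cons false (q * z)) (a · z) (b · z) ⟩
  (cons false (p * z) + a · z) + (cons false (q * z) + b · z) ≡⟨ sym (cong₂ _+_ (*-cons a p z) (*-cons b q z)) ⟩
  cons a p * z + cons b q * z                              ∎

*-consʳ : ∀ x b q → x * cons b q ≡ cons false (x * q) + b · x
*-consʳ = Poly-ind _ (λ { false q → refl ; true q → refl }) step
  where
  middle : ∀ a b p q → cons false (b · p) + a · cons b q ≡ cons false (a · q) + b · cons a p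
  middle false false p q = refl
  middle false true  p q = +-identityʳ _
  middle true  false p q = sym (+-identityʳ _)
  middle true  true  p q =
    trans (+-cons false true p q) (trans (cong (cons true) (+-comm p q)) (sym (+-cons false true q p)))
  step : ∀ a p → (∀ b q → p * cons b q ≡ cons false (p * q) + b · p)
       → ∀ b q → cons a p * cons b q ≡ cons false (cons a p * q) + b · cons a p
  step a p ih b q = begin
    cons a p * cons b q                                        ≡⟨ *-cons a p (cons b q) ⟩
    cons false (p * cons b q) + a · cons b q                   ≡⟨ cong (λ u → cons false u + a · cons b q) (ih b q) ⟩
    cons false (xpq + b · p) + a · cons b q                    ≡⟨ cong (_+ a · cons b q) (shift-+ xpq (b · p)) ⟩
    (cons false xpq + cons false (b · p)) + a · cons b q       ≡⟨ +-assoc (cons false xpq) _ _ ⟩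
    cons false xpq + (cons false (b · p) + a · cons b q)       ≡⟨ cong (cons false xpq +_) (middle a b p q) ⟩
    cons false xpq + (cons false (a · q) + b · cons a p)       ≡⟨ sym (+-assoc (cons false xpq) _ _) ⟩
    (cons false xpq + cons false (a · q)) + b · cons a p       ≡⟨ cong (_+ b · cons a p) (sym (shift-+ xpq (a · q))) ⟩
    cons false (xpq + a · q) + b · cons a p                    ≡⟨ cong (λ u → cons false u + b · cons a p) (sym (*-cons a p q)) ⟩
    cons false (cons a p * q) + b · cons a p                   ∎
    where
    xpq = cons false (p * q)

*-comm : ∀ x y → x * y ≡ y * x
*-comm = Poly-ind _ (λ y → sym (*-zeroʳ y)) λ a p ih y →
  trans (*-cons a p y) (trans (cong (λ u → cons false u + a · y) (ih y)) (sym (*-consʳ y a p)))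

*-distribˡ : ∀ x y z → x * (y + z) ≡ x * y + x * z
*-distribˡ x y z = trans (*-comm x (y + z)) (trans (*-distribʳ y z x) (cong₂ _+_ (*-comm y x) (*-comm z x)))

*-assoc : ∀ x y z → (x * y) * z ≡ x * (y * z)
*-assoc = Poly-ind _ (λ _ _ → refl) λ a p ih y z → begin
  (cons a p * y) * z                        ≡⟨ cong (_* z) (*-cons a p y) ⟩
  (cons false (p * y) + a · y) * z          ≡⟨ *-distribʳ (cons false (p * y)) (a · y) z ⟩
  cons false (p * y) * z + a · y * z        ≡⟨ cong₂ _+_ (*-cons false (p * y) z) (·-* a y z) ⟩
  cons false (p * y * z) + 0ₚ + a · (y * z) ≡⟨ cong (_+ a · (y * z)) (+-identityʳ (cons false (p * y * z))) ⟩
  cons false (p * y * z) + a · (y * z)      ≡⟨ cong (λ u → cons false u + a · (y * z)) (ih y z) ⟩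
  cons false (p * (y * z)) + a · (y * z)    ≡⟨ sym (*-cons a p (y * z)) ⟩
  cons a p * (y * z)                        ∎
  where
  ·-* : ∀ a y z → a · y * z ≡ a · (y * z)
  ·-* false y z = refl
  ·-* true  y z = refl

+-*-isCommutativeRing : IsCommutativeRing _+_ _*_ (λ p → p) 0ₚ 1ₚ
+-*-isCommutativeRing = record
  { isRing = record
    { +-isAbelianGroup = record
      { isGroup = record
        { isMonoid = record
          { isSemigroup = record
            { isMagma = record { isEquivalence = isEquivalence ; ∙-cong = cong₂ _+_ }
            ; assoc = +-assoc }
          ; identity = +-identityˡ , +-identityʳ }
        ; inverse = +-self , +-self
        ; ⁻¹-cong = λ e → e }
      ; comm = +-comm }
    ; *-cong = cong₂ _*_
    ; *-assoc = *-assoc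
    ; *-identity = *-identityˡ , *-identityʳ
    ; distrib = *-distribˡ , (λ x y z → *-distribʳ y z x) }
  ; *-comm = *-comm }

commutativeRing : CommutativeRing _ _
commutativeRing = record { isCommutativeRing = +-*-isCommutativeRing }

≟0ₚ : ∀ p → Maybe (0ₚ ≡ p)
≟0ₚ 0ₚ    = just refl
≟0ₚ ⟨ _ ⟩ = nothing

open import Tactic.RingSolver.NonReflective (fromCommutativeRing commutativeRing ≟0ₚ)
  using (solve; _⊜_; _⊕_; _⊗_; Κ)

+-cancelʳ : ∀ x y z → x + z ≡ y + z → x ≡ y
+-cancelʳ x y z x+z≡y+z = begin
  x           ≡⟨ solve 2 (λ x z → x ⊜ ((x ⊕ z) ⊕ z)) refl x z ⟩
  x + z + z   ≡⟨ cong (_+ z) x+z≡y+z ⟩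
  y + z + z   ≡⟨ solve 2 (λ y z → ((y ⊕ z) ⊕ z) ⊜ y) refl y z ⟩
  y           ∎

size⁺≥1 : ∀ p → 1 ≤ size⁺ p
size⁺≥1 1⁺       = s≤s z≤n
size⁺≥1 (_ x+ _) = s≤s z≤n

size≥1 : ∀ {x} → x ≢ 0ₚ → 1 ≤ size x
size≥1 {0ₚ}    x≢0 = ⊥-elim (x≢0 refl)
size≥1 {⟨ p ⟩} _   = size⁺≥1 p

size≤0⇒≡0ₚ : ∀ {x} → size x ≤ 0 → x ≡ 0ₚ
size≤0⇒≡0ₚ {0ₚ}             _ = refl
size≤0⇒≡0ₚ {⟨ 1⁺ ⟩}         ()
size≤0⇒≡0ₚ {⟨ _ x+ _ ⟩}     ()

size≡1⇒≡1ₚ : ∀ {x} → size x ≡ 1 → x ≡ 1ₚ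
size≡1⇒≡1ₚ {⟨ 1⁺ ⟩}             _  = refl
size≡1⇒≡1ₚ {⟨ 1⁺ x+ _ ⟩}        ()
size≡1⇒≡1ₚ {⟨ (_ x+ _) x+ _ ⟩}  ()

size-cons : ∀ b x → size (cons b x) ≤ suc (size x)
size-cons false 0ₚ    = z≤n
size-cons true  0ₚ    = s≤s z≤n
size-cons false ⟨ _ ⟩ = ℕ.≤-refl
size-cons true  ⟨ _ ⟩ = ℕ.≤-refl

size-divX : ∀ x → size (divX x) ≡ pred (size x)
size-divX 0ₚ         = refl
size-divX ⟨ 1⁺ ⟩     = refl
size-divX ⟨ _ x+ _ ⟩ = refl

add⁺-< : ∀ p q → size⁺ q < size⁺ p → Σ Poly⁺ λ r → add⁺ p q ≡ ⟨ r ⟩ × size⁺ r ≡ size⁺ p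
add⁺-< 1⁺       q        q<1 = ⊥-elim (ℕ.<-irrefl refl (ℕ.<-≤-trans q<1 (size⁺≥1 q)))
add⁺-< (p x+ a) 1⁺       _   = p x+ not a , refl , refl
add⁺-< (p x+ a) (q x+ b) (s≤s q<p) with add⁺-< p q q<p
... | r , p+q≡r , size-r = r x+ (a xor b) , trans (cong (cons (a xor b)) p+q≡r) (cons-⟨⟩ (a xor b) r) , cong suc size-r

size-+-≡ : ∀ x y → size x ≡ size y → 1 ≤ size x → size (x + y) < size x
size-+-≡ ⟨ p ⟩ ⟨ q ⟩ e _ = go p q e
  where
  go : ∀ p q → size⁺ p ≡ size⁺ q → size (add⁺ p q) < size⁺ p
  go 1⁺       1⁺       _ = s≤s z≤n
  go 1⁺       (q x+ _) e = ⊥-elim (ℕ.<-irrefl (ℕ.suc-injective e) (size⁺≥1 q))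
  go (p x+ _) 1⁺       e = ⊥-elim (ℕ.<-irrefl (sym (ℕ.suc-injective e)) (size⁺≥1 p))
  go (p x+ a) (q x+ b) e = ℕ.≤-<-trans (size-cons (a xor b) (add⁺ p q)) (s≤s (go p q (ℕ.suc-injective e)))
size-+-≡ ⟨ p ⟩ 0ₚ e _ = ⊥-elim (ℕ.<-irrefl (sym e) (size⁺≥1 p))

size-*⁺ : ∀ p q → Σ Poly⁺ λ r → mul⁺ p ⟨ q ⟩ ≡ ⟨ r ⟩ × suc (size⁺ r) ≡ size⁺ p +ℕ size⁺ q
size-*⁺ 1⁺           q = q , refl , refl
size-*⁺ (p x+ false) q with size-*⁺ p q
... | r , pq≡r , size-r = r x+ false , trans (+-identityʳ _) (cong (cons false) pq≡r) , cong suc size-r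
size-*⁺ (p x+ true)  q with size-*⁺ p q
... | r , pq≡r , size-r with add⁺-< (r x+ false) q (subst (size⁺ q <_) (sym size-r) (ℕ.m<n+m (size⁺ q) (size⁺≥1 p)))
... | r′ , xr+q≡r′ , size-r′ =
  r′ , trans (cong (λ u → cons false u + ⟨ q ⟩) pq≡r) xr+q≡r′ , cong suc (trans size-r′ size-r)

*-≢0 : ∀ {x y} → x ≢ 0ₚ → y ≢ 0ₚ → x * y ≢ 0ₚ
*-≢0 {0ₚ}              x≢0 _   = ⊥-elim (x≢0 refl)
*-≢0 {⟨ _ ⟩} {0ₚ}      _   y≢0 = ⊥-elim (y≢0 refl)
*-≢0 {⟨ p ⟩} {⟨ q ⟩}   _   _   pq≡0 with size-*⁺ p q
... | r , pq≡r , _ with trans (sym pq≡r) pq≡0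
... | ()

size-* : ∀ {x y} → x ≢ 0ₚ → y ≢ 0ₚ → suc (size (x * y)) ≡ size x +ℕ size y
size-* {0ₚ}            x≢0 _   = ⊥-elim (x≢0 refl)
size-* {⟨ _ ⟩} {0ₚ}    _   y≢0 = ⊥-elim (y≢0 refl)
size-* {⟨ p ⟩} {⟨ q ⟩} _   _   with size-*⁺ p q
... | r , pq≡r , size-r rewrite pq≡r = size-r

eq⁺-refl : ∀ p → eq⁺ p p ≡ true
eq⁺-refl 1⁺           = refl
eq⁺-refl (p x+ false) rewrite eq⁺-refl p = refl
eq⁺-refl (p x+ true)  rewrite eq⁺-refl p = refl

==-refl : ∀ p → (p == p) ≡ true
==-refl 0ₚ    = refl
==-refl ⟨ p ⟩ = eq⁺-refl p

eq⁺⇒≡ : ∀ p q → eq⁺ p q ≡ true → p ≡ q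
eq⁺⇒≡ 1⁺       1⁺       _ = refl
eq⁺⇒≡ (p x+ a) (q x+ b) e with eq⁺ p q in p=q
eq⁺⇒≡ (p x+ false) (q x+ false) _  | true = cong (_x+ false) (eq⁺⇒≡ p q p=q)
eq⁺⇒≡ (p x+ true)  (q x+ true)  _  | true = cong (_x+ true) (eq⁺⇒≡ p q p=q)
eq⁺⇒≡ (p x+ false) (q x+ true)  () | true
eq⁺⇒≡ (p x+ true)  (q x+ false) () | true

==⇒≡ : ∀ p q → (p == q) ≡ true → p ≡ q
==⇒≡ 0ₚ    0ₚ    _ = refl
==⇒≡ ⟨ p ⟩ ⟨ q ⟩ e = cong ⟨_⟩ (eq⁺⇒≡ p q e)

≢⇒==false : ∀ {p q} → p ≢ q → (p == q) ≡ false
≢⇒==false {p} {q} p≢q with p == q in p=q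
... | true  = ⊥-elim (p≢q (==⇒≡ p q p=q))
... | false = refl

==false⇒≢ : ∀ {p q} → (p == q) ≡ false → p ≢ q
==false⇒≢ {p} p=q refl with () ← trans (sym (==-refl p)) p=q

infix 4 _≟_
_≟_ : ∀ p q → Dec (p ≡ q)
p ≟ q with p == q in p=q
... | true  = yes (==⇒≡ p q p=q)
... | false = no (==false⇒≢ p=q)

if-==-refl : ∀ p x → (if p == p then x else 0ₚ) ≡ x
if-==-refl p x rewrite ==-refl p = refl

if-==-≢ : ∀ {p q} x → p ≢ q → (if p == q then x else 0ₚ) ≡ 0ₚ
if-==-≢ x p≢q rewrite ≢⇒==false p≢q = refl

*≡0⇒≡0 : ∀ {x y} → x ≢ 0ₚ → x * y ≡ 0ₚ → y ≡ 0ₚ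
*≡0⇒≡0 {y = 0ₚ}    _   _    = refl
*≡0⇒≡0 {y = ⟨ _ ⟩} x≢0 xy≡0 = ⊥-elim (*-≢0 x≢0 (λ ()) xy≡0)

*-cancelˡ : ∀ {x y z} → x ≢ 0ₚ → x * y ≡ x * z → y ≡ z
*-cancelˡ {x} {y} {z} x≢0 xy≡xz = +-cancelʳ y z z (trans (*≡0⇒≡0 x≢0 (begin
  x * (y + z)     ≡⟨ *-distribˡ x y z ⟩
  x * y + x * z   ≡⟨ cong (_+ x * z) xy≡xz ⟩
  x * z + x * z   ≡⟨ +-self (x * z) ⟩
  0ₚ              ∎)) (sym (+-self z)))

^-+ : ∀ P a b → P ^ a * P ^ b ≡ P ^ (a +ℕ b)
^-+ P zero    b = refl
^-+ P (suc a) b = trans (*-assoc P (P ^ a) (P ^ b)) (cong (P *_) (^-+ P a b))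

^-≢0 : ∀ {P} → P ≢ 0ₚ → ∀ n → P ^ n ≢ 0ₚ
^-≢0 P≢0 zero    ()
^-≢0 P≢0 (suc n) = *-≢0 P≢0 (^-≢0 P≢0 n)

module NonConstantPowers {P : Poly} (2≤size : 2 ≤ size P) where

  P≢0 : P ≢ 0ₚ
  P≢0 P≡0 = ℕ.<-irrefl (cong size (sym P≡0)) (ℕ.<-≤-trans (s≤s z≤n) 2≤size)

  size-^-< : ∀ n → size (P ^ n) < size (P ^ suc n)
  size-^-< n = ℕ.≤-pred (subst (suc (suc (size (P ^ n))) ≤_) (sym (size-* P≢0 (^-≢0 P≢0 n)))
                                (ℕ.+-monoˡ-≤ (size (P ^ n)) 2≤size))

  size-^-mono : ∀ {i j} → i ≤ j → size (P ^ i) ≤ size (P ^ j)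
  size-^-mono {j = zero} z≤n = ℕ.≤-refl
  size-^-mono {i} {suc j} i≤1+j with ℕ.m≤n⇒m<n∨m≡n i≤1+j
  ... | inj₂ refl       = ℕ.≤-refl
  ... | inj₁ (s≤s i≤j)  = ℕ.≤-trans (size-^-mono i≤j) (ℕ.<⇒≤ (size-^-< j))

  size-^-strictMono : ∀ {i j} → i < j → size (P ^ i) < size (P ^ j)
  size-^-strictMono {i} {suc j} (s≤s i≤j) = ℕ.≤-<-trans (size-^-mono i≤j) (size-^-< j)

  ^-injective : ∀ {i j} → P ^ i ≡ P ^ j → i ≡ j
  ^-injective {i} {j} Pⁱ≡Pʲ with ℕ.<-cmp i j
  ... | tri< i<j _ _ = ⊥-elim (ℕ.<-irrefl (cong size Pⁱ≡Pʲ) (size-^-strictMono i<j))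
  ... | tri≈ _ i≡j _ = i≡j
  ... | tri> _ _ j<i = ⊥-elim (ℕ.<-irrefl (cong size (sym Pⁱ≡Pʲ)) (size-^-strictMono j<i))

Division : Poly → Poly → Set
Division A B = Σ Poly λ Q → Σ Poly λ R → A ≡ B * Q + R × size R < size B

divide : ∀ A {B} → B ≢ 0ₚ → Division A B
divide A {B} B≢0 =
  Poly-ind (λ A → Division A B) (0ₚ , 0ₚ , sym (trans (+-identityʳ (B * 0ₚ)) (*-zeroʳ B)) , size≥1 B≢0) step A
  where
  B*xQ : ∀ Q → B * cons false Q ≡ cons false (B * Q)
  B*xQ Q = trans (*-consʳ B false Q) (+-identityʳ _)
  step : ∀ a A → Division A B → Division (cons a A) B
  step a A (Q , R , A≡BQ+R , R<B) with ℕ.m≤n⇒m<n∨m≡n (ℕ.≤-trans (size-cons a R) R<B)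
  ... | inj₁ aR<B = cons false Q , cons a R , e , aR<B
    where
    e : cons a A ≡ B * cons false Q + cons a R
    e = begin
      cons a A                          ≡⟨ cong (cons a) A≡BQ+R ⟩
      cons a (B * Q + R)                ≡⟨ sym (+-cons false a (B * Q) R) ⟩
      cons false (B * Q) + cons a R     ≡⟨ cong (_+ cons a R) (sym (B*xQ Q)) ⟩
      B * cons false Q + cons a R       ∎
  ... | inj₂ aR≡B = cons true Q , cons a R + B , e
                  , subst (size (cons a R + B) <_) aR≡B (size-+-≡ (cons a R) B aR≡B (subst (1 ≤_) (sym aR≡B) (size≥1 B≢0)))
    where
    e : cons a A ≡ B * cons true Q + (cons a R + B)
    e = begin
      cons a A                                   ≡⟨ cong (cons a) A≡BQ+R ⟩
      cons a (B * Q + R)                         ≡⟨ sym (+-cons false a (B * Q) R) ⟩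
      cons false (B * Q) + cons a R
        ≡⟨ solve 3 (λ x r b → (x ⊕ r) ⊜ ((x ⊕ b) ⊕ (r ⊕ b))) refl (cons false (B * Q)) (cons a R) B ⟩
      cons false (B * Q) + B + (cons a R + B)    ≡⟨ cong (_+ (cons a R + B)) (sym (*-consʳ B true Q)) ⟩
      B * cons true Q + (cons a R + B)           ∎

record Bézout (A B : Poly) : Set where
  field
    G U V   : Poly
    G≡UA+VB : G ≡ U * A + V * B
    G∣A     : G ∣ A
    G∣B     : G ∣ B

bézout-0ₚ : ∀ A → Bézout A 0ₚ
bézout-0ₚ A = record
  { G = A ; U = 1ₚ ; V = 0ₚ ; G≡UA+VB = sym (+-identityʳ A) ; G∣A = 1ₚ , *-identityʳ A ; G∣B = 0ₚ , *-zeroʳ A }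

-- The bound n on size B makes the Euclidean recursion structural.
bézout : ∀ n A B → size B ≤ n → Bézout A B
bézout zero    A B     B≤0 = subst (Bézout A) (sym (size≤0⇒≡0ₚ B≤0)) (bézout-0ₚ A)
bézout (suc n) A 0ₚ    _   = bézout-0ₚ A
bézout (suc n) A ⟨ p ⟩ B≤1+n with divide A {⟨ p ⟩} (λ ())
... | Q , R , A≡BQ+R , R<B with bézout n ⟨ p ⟩ R (ℕ.≤-pred (ℕ.<-≤-trans R<B B≤1+n))
... | record { G = G ; U = U ; V = V ; G≡UA+VB = G≡UB+VR ; G∣A = b , Gb≡B ; G∣B = r , Gr≡R } =
  record { G = G ; U = V ; V = U + V * Q ; G≡UA+VB = G≡VA+[U+VQ]B ; G∣A = b * Q + r , G[bQ+r]≡A ; G∣B = b , Gb≡B }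
  where
  B = ⟨ p ⟩
  G≡VA+[U+VQ]B : G ≡ V * A + (U + V * Q) * B
  G≡VA+[U+VQ]B = trans G≡UB+VR (trans
    (solve 5 (λ u v b q r → ((u ⊗ b) ⊕ (v ⊗ r)) ⊜ ((v ⊗ ((b ⊗ q) ⊕ r)) ⊕ ((u ⊕ (v ⊗ q)) ⊗ b))) refl U V B Q R)
    (cong (λ a → V * a + (U + V * Q) * B) (sym A≡BQ+R)))
  G[bQ+r]≡A : G * (b * Q + r) ≡ A
  G[bQ+r]≡A = trans (solve 4 (λ g b q r → (g ⊗ ((b ⊗ q) ⊕ r)) ⊜ (((g ⊗ b) ⊗ q) ⊕ (g ⊗ r))) refl G b Q r)
    (trans (cong₂ (λ x y → x * Q + y) Gb≡B Gr≡R) (sym A≡BQ+R))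

irreducible⇒2≤size : ∀ {P} → Irreducible P → 2 ≤ size P
irreducible⇒2≤size (P≢0 , P≢1 , _) with ℕ.m≤n⇒m<n∨m≡n (size≥1 P≢0)
... | inj₁ 1<size  = 1<size
... | inj₂ 1≡size  = ⊥-elim (P≢1 (size≡1⇒≡1ₚ (sym 1≡size)))

irreducible⇒prime : ∀ {P} → Irreducible P → ∀ D E → P ∣ (D * E) → (P ∣ D) ⊎ (P ∣ E)
irreducible⇒prime {P} (_ , _ , irr) D E (k , Pk≡DE) with bézout (size D) P D ℕ.≤-refl
... | record { G = G ; U = U ; V = V ; G≡UA+VB = G≡UP+VD ; G∣A = h , Gh≡P ; G∣B = d , Gd≡D } with irr G h Gh≡P
... | inj₂ refl = inj₁ (d , trans (cong (_* d) (trans (sym Gh≡P) (*-identityʳ G))) Gd≡D)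
... | inj₁ refl = inj₂ (U * E + V * k , (begin
  P * (U * E + V * k)
    ≡⟨ solve 5 (λ p u e v k → (p ⊗ ((u ⊗ e) ⊕ (v ⊗ k))) ⊜ (((u ⊗ p) ⊗ e) ⊕ (v ⊗ (p ⊗ k)))) refl P U E V k ⟩
  U * P * E + V * (P * k)
    ≡⟨ cong (λ z → U * P * E + V * z) Pk≡DE ⟩
  U * P * E + V * (D * E)
    ≡⟨ solve 5 (λ p u e v d → (((u ⊗ p) ⊗ e) ⊕ (v ⊗ (d ⊗ e))) ⊜ (((u ⊗ p) ⊕ (v ⊗ d)) ⊗ e)) refl P U E V D ⟩
  (U * P + V * D) * E
    ≡⟨ cong (_* E) (sym G≡UP+VD) ⟩
  1ₚ * E ∎))

m+n≡2⇒m≡1 : ∀ {m n} → 1 ≤ m → 1 ≤ n → m +ℕ n ≡ 2 → m ≡ 1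
m+n≡2⇒m≡1 {suc zero}    _ _       _ = refl
m+n≡2⇒m≡1 {suc (suc m)} _ (s≤s _) e = ⊥-elim (ℕ.m+1+n≢0 m (ℕ.suc-injective (ℕ.suc-injective e)))

*≡1ₚ⇒≡1ₚ : ∀ {D E} → D * E ≡ 1ₚ → D ≡ 1ₚ
*≡1ₚ⇒≡1ₚ {D} {E} DE≡1 = size≡1⇒≡1ₚ (m+n≡2⇒m≡1 (size≥1 D≢0) (size≥1 E≢0)
  (trans (sym (size-* D≢0 E≢0)) (cong (λ z → suc (size z)) DE≡1)))
  where
  0ₚ≢1ₚ : 0ₚ ≢ 1ₚ
  0ₚ≢1ₚ ()
  D≢0 : D ≢ 0ₚ
  D≢0 D≡0 = 0ₚ≢1ₚ (trans (sym (cong (_* E) D≡0)) DE≡1)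
  E≢0 : E ≢ 0ₚ
  E≢0 E≡0 = 0ₚ≢1ₚ (trans (sym (*-zeroʳ D)) (trans (cong (D *_) (sym E≡0)) DE≡1))

-- Finite sums and power series

∑< : ℕ → (ℕ → Poly) → Poly
∑< zero    f = 0ₚ
∑< (suc n) f = f 0 + ∑< n (λ i → f (suc i))

syntax ∑< n (λ i → e) = ∑[ i < n ] e

∑-cong : ∀ n {f g} → (∀ i → i < n → f i ≡ g i) → ∑< n f ≡ ∑< n g
∑-cong zero    _   = refl
∑-cong (suc n) f≡g = cong₂ _+_ (f≡g 0 (s≤s z≤n)) (∑-cong n (λ i i<n → f≡g (suc i) (s≤s i<n)))

∑-zero : ∀ n f → (∀ i → i < n → f i ≡ 0ₚ) → ∑< n f ≡ 0ₚ
∑-zero zero    f _   = refl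
∑-zero (suc n) f f≡0 = cong₂ _+_ (f≡0 0 (s≤s z≤n)) (∑-zero n _ (λ i i<n → f≡0 (suc i) (s≤s i<n)))

∑-single : ∀ n f j → j < n → (∀ i → i < n → i ≢ j → f i ≡ 0ₚ) → ∑< n f ≡ f j
∑-single (suc n) f zero _ f≡0 =
  trans (cong (f 0 +_) (∑-zero n _ (λ i i<n → f≡0 (suc i) (s≤s i<n) (λ ())))) (+-identityʳ (f 0))
∑-single (suc n) f (suc j) (s≤s j<n) f≡0 =
  trans (cong (_+ ∑< n (λ i → f (suc i))) (f≡0 0 (s≤s z≤n) (λ ())))
        (∑-single n (λ i → f (suc i)) j j<n (λ i i<n i≢j → f≡0 (suc i) (s≤s i<n) (λ e → i≢j (ℕ.suc-injective e))))

∑-+ : ∀ n f g → ∑[ i < n ] (f i + g i) ≡ ∑< n f + ∑< n g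
∑-+ zero    f g = refl
∑-+ (suc n) f g = trans (cong (f 0 + g 0 +_) (∑-+ n (λ i → f (suc i)) (λ i → g (suc i)))) (interchange (f 0) (g 0) _ _)

∑-*ˡ : ∀ n x f → ∑[ i < n ] (x * f i) ≡ x * ∑< n f
∑-*ˡ zero    x f = sym (*-zeroʳ x)
∑-*ˡ (suc n) x f = trans (cong (x * f 0 +_) (∑-*ˡ n x (λ i → f (suc i)))) (sym (*-distribˡ x (f 0) _))

sumP-++ : ∀ xs ys → sumP (xs ++ ys) ≡ sumP xs + sumP ys
sumP-++ []       ys = refl
sumP-++ (x ∷ xs) ys = trans (cong (x +_) (sumP-++ xs ys)) (sym (+-assoc x (sumP xs) (sumP ys)))

sumP-concatMap : ∀ {A : Set} (f : A → List Poly) xs → sumP (concatMap f xs) ≡ sumP (map (λ x → sumP (f x)) xs)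
sumP-concatMap f []       = refl
sumP-concatMap f (x ∷ xs) = trans (sumP-++ (f x) (concatMap f xs)) (cong (sumP (f x) +_) (sumP-concatMap f xs))

sumP-map-cong : ∀ {A : Set} {f g : A → Poly} xs → (∀ x → f x ≡ g x) → sumP (map f xs) ≡ sumP (map g xs)
sumP-map-cong []       _   = refl
sumP-map-cong (x ∷ xs) f≡g = cong₂ _+_ (f≡g x) (sumP-map-cong xs f≡g)

sumP-map-zero : ∀ {A : Set} {f : A → Poly} xs → (∀ x → f x ≡ 0ₚ) → sumP (map f xs) ≡ 0ₚ
sumP-map-zero []       _   = refl
sumP-map-zero (x ∷ xs) f≡0 = cong₂ _+_ (f≡0 x) (sumP-map-zero xs f≡0)

sumP-map-∑ : ∀ {A : Set} n (F : ℕ → A → Poly) xs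
           → sumP (map (λ x → ∑[ i < n ] F i x) xs) ≡ ∑[ i < n ] sumP (map (F i) xs)
sumP-map-∑ n F []       = sym (∑-zero n _ (λ _ _ → refl))
sumP-map-∑ n F (x ∷ xs) = trans (cong (∑[ i < n ] F i x +_) (sumP-map-∑ n F xs))
                                (sym (∑-+ n (λ i → F i x) (λ i → sumP (map (F i) xs))))

infixl 7 _⋆_
_⋆_ : (ℕ → Poly) → (ℕ → Poly) → ℕ → Poly
(s ⋆ f) n = ∑[ i < suc n ] (s i * f (n ∸ i))

δ₀ : ℕ → Poly
δ₀ zero    = 1ₚ
δ₀ (suc _) = 0ₚ

⋆-cancelˡ : ∀ {s f h} → s 0 ≡ 1ₚ → (∀ n → (s ⋆ f) n ≡ (s ⋆ h) n) → ∀ n → f n ≡ h n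
⋆-cancelˡ {s} {f} {h} s₀≡1 s⋆f≡s⋆h = <-rec _ step
  where
  lead : ∀ f → (s ⋆ f) 0 ≡ f 0
  lead f = trans (+-identityʳ _) (cong (_* f 0) s₀≡1)
  tail : (ℕ → Poly) → ℕ → Poly
  tail f m = ∑[ i < suc m ] (s (suc i) * f (m ∸ i))
  split : ∀ f m → (s ⋆ f) (suc m) ≡ f (suc m) + tail f m
  split f m = cong (λ c → c * f (suc m) + tail f m) s₀≡1
  step : ∀ n → (∀ {k} → k < n → f k ≡ h k) → f n ≡ h n
  step zero    _  = trans (sym (lead f)) (trans (s⋆f≡s⋆h 0) (lead h))
  step (suc m) ih = +-cancelʳ (f (suc m)) (h (suc m)) (tail h m) (begin
    f (suc m) + tail h m
      ≡⟨ cong (f (suc m) +_) (∑-cong (suc m) (λ i _ → cong (s (suc i) *_) (sym (ih (s≤s (ℕ.m∸n≤m m i)))))) ⟩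
    f (suc m) + tail f m    ≡⟨ sym (split f m) ⟩
    (s ⋆ f) (suc m)         ≡⟨ s⋆f≡s⋆h (suc m) ⟩
    (s ⋆ h) (suc m)         ≡⟨ split h m ⟩
    h (suc m) + tail h m    ∎)

size-divX-≤ : ∀ {n} x → size x ≤ suc n → size (divX x) ≤ n
size-divX-≤ {n} x x≤1+n = subst (_≤ n) (sym (size-divX x)) (ℕ.pred-mono-≤ x≤1+n)

allLen-complete : ∀ n {x} → size x ≤ n → x ∈ allLen n
allLen-complete zero    x≤0 = subst (_∈ allLen 0) (sym (size≤0⇒≡0ₚ x≤0)) (here refl)
allLen-complete (suc n) {x} x≤1+n = subst (_∈ allLen (suc n)) (cons-coeff₀-divX x)
  (∈-concatMap⁺ _ (lose (allLen-complete n (size-divX-≤ x x≤1+n)) (both (coeff₀ x))))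
  where
  both : ∀ b → cons b (divX x) ∈ cons false (divX x) ∷ cons true (divX x) ∷ []
  both false = here refl
  both true  = there (here refl)

any-∈ : ∀ {A : Set} (p : A → Bool) {x xs} → x ∈ xs → p x ≡ true → any p xs ≡ true
any-∈ p (here refl) px≡t rewrite px≡t = refl
any-∈ p {xs = y ∷ _} (there x∈xs) px≡t rewrite any-∈ p x∈xs px≡t = ∨-zeroʳ (p y)

all-∈ : ∀ {A : Set} (p : A → Bool) {x xs} → x ∈ xs → p x ≡ false → all p xs ≡ false
all-∈ p (here refl) px≡f rewrite px≡f = refl
all-∈ p {xs = y ∷ _} (there x∈xs) px≡f rewrite all-∈ p x∈xs px≡f = ∧-zeroʳ (p y)

all-true : ∀ {A : Set} (p : A → Bool) xs → (∀ x → p x ≡ true) → all p xs ≡ true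
all-true p []       _      = refl
all-true p (y ∷ xs) p≡t rewrite p≡t y = all-true p xs p≡t

sumP-map-allLen-suc : ∀ (F : Poly → Poly) xs
  → sumP (map F (concatMap (λ p → cons false p ∷ cons true p ∷ []) xs))
  ≡ sumP (map (λ p → F (cons false p) + F (cons true p)) xs)
sumP-map-allLen-suc F []       = refl
sumP-map-allLen-suc F (p ∷ xs) =
  trans (sym (+-assoc (F (cons false p)) (F (cons true p)) _)) (cong (F (cons false p) + F (cons true p) +_) (sumP-map-allLen-suc F xs))

sumP-allLen-single : ∀ n (F : Poly → Poly) e → size e ≤ n
  → (∀ x → size x ≤ n → x ≢ e → F x ≡ 0ₚ) → sumP (map F (allLen n)) ≡ F e
sumP-allLen-single zero    F e e≤0 _ = trans (+-identityʳ (F 0ₚ)) (cong F (sym (size≤0⇒≡0ₚ e≤0)))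
sumP-allLen-single (suc n) F e e≤1+n F≡0 =
  trans (sumP-map-allLen-suc F (allLen n)) (trans (sumP-allLen-single n F′ d (size-divX-≤ e e≤1+n) F′≡0) F′d≡Fe)
  where
  d  = divX e
  F′ : Poly → Poly
  F′ p = F (cons false p) + F (cons true p)
  cons≡e : ∀ {b} → coeff₀ e ≡ b → cons b d ≡ e
  cons≡e refl = cons-coeff₀-divX e
  F-cons≡0 : ∀ b x → size x ≤ n → cons b x ≢ e → F (cons b x) ≡ 0ₚ
  F-cons≡0 b x x≤n = F≡0 (cons b x) (ℕ.≤-trans (size-cons b x) (s≤s x≤n))
  F′≡0 : ∀ x → size x ≤ n → x ≢ d → F′ x ≡ 0ₚ
  F′≡0 x x≤n x≢d = cong₂ _+_ (F-cons≡0 false x x≤n (x≢d ∘ divX≡)) (F-cons≡0 true x x≤n (x≢d ∘ divX≡))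
    where
    divX≡ : ∀ {b} → cons b x ≡ e → x ≡ d
    divX≡ {b} e′ = trans (sym (divX-cons b x)) (cong divX e′)
  F-cons-d≡0 : ∀ b → b ≢ coeff₀ e → F (cons b d) ≡ 0ₚ
  F-cons-d≡0 b b≢c =
    F-cons≡0 b d (size-divX-≤ e e≤1+n) (λ e′ → b≢c (trans (sym (coeff₀-cons b d)) (cong coeff₀ e′)))
  F′d≡Fe : F′ d ≡ F e
  F′d≡Fe with coeff₀ e in c
  ... | false = trans (cong₂ _+_ (cong F (cons≡e c)) (F-cons-d≡0 true (λ t≡c → case trans t≡c c of λ ())))
                      (+-identityʳ (F e))
  ... | true  = cong₂ _+_ (F-cons-d≡0 false (λ f≡c → case trans f≡c c of λ ())) (cong F (cons≡e c))

-- Powers of an irreducible polynomial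

coprime?-1ₚˡ : ∀ E → coprime? 1ₚ E ≡ true
coprime?-1ₚˡ E rewrite ∨-zeroʳ (not (divides? 1ₚ E)) = refl

coprime?-1ₚʳ : ∀ D → coprime? D 1ₚ ≡ true
coprime?-1ₚʳ D = all-true _ (cands D) no-common-factor
  where
  no-common-factor : ∀ C → (not (divides? C D ∧ divides? C 1ₚ) ∨ (C == 1ₚ)) ≡ true
  no-common-factor C rewrite *-zeroʳ C | *-identityʳ C with C == 1ₚ
  ... | true  = ∨-zeroʳ _
  ... | false rewrite ∧-zeroʳ (divides? C D) = refl

module PrimePower {P : Poly} (P-irr : Irreducible P) where

  open NonConstantPowers {P} (irreducible⇒2≤size P-irr) public

  *≡^⇒≡^ : ∀ n D E → D * E ≡ P ^ n → Σ ℕ λ i → i ≤ n × D ≡ P ^ i × E ≡ P ^ (n ∸ i)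
  *≡^⇒≡^ zero D E DE≡1 = 0 , z≤n , D≡1 , trans (sym (cong (_* E) D≡1)) DE≡1
    where
    D≡1 : D ≡ 1ₚ
    D≡1 = *≡1ₚ⇒≡1ₚ DE≡1
  *≡^⇒≡^ (suc m) D E DE≡Pⁿ with irreducible⇒prime P-irr D E (P ^ m , sym DE≡Pⁿ)
  ... | inj₁ (d , Pd≡D) with *≡^⇒≡^ m d E (*-cancelˡ P≢0 (begin
        P * (d * E)   ≡⟨ sym (*-assoc P d E) ⟩
        P * d * E     ≡⟨ cong (_* E) Pd≡D ⟩
        D * E         ≡⟨ DE≡Pⁿ ⟩
        P * P ^ m     ∎))
  ...   | i , i≤m , d≡Pⁱ , E≡P^m-i = suc i , s≤s i≤m , trans (sym Pd≡D) (cong (P *_) d≡Pⁱ) , E≡P^m-i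
  *≡^⇒≡^ (suc m) D E DE≡Pⁿ | inj₂ (e , Pe≡E) with *≡^⇒≡^ m D e (*-cancelˡ P≢0 (begin
        P * (D * e)   ≡⟨ solve 3 (λ p d x → (p ⊗ (d ⊗ x)) ⊜ (d ⊗ (p ⊗ x))) refl P D e ⟩
        D * (P * e)   ≡⟨ cong (D *_) Pe≡E ⟩
        D * E         ≡⟨ DE≡Pⁿ ⟩
        P * P ^ m     ∎))
  ...   | i , i≤m , D≡Pⁱ , e≡P^m-i = i , ℕ.m≤n⇒m≤1+n i≤m , D≡Pⁱ
        , trans (sym Pe≡E) (trans (cong (P *_) e≡P^m-i) (cong (P ^_) (sym (ℕ.+-∸-assoc 1 i≤m))))

  ∑-factorisations : ∀ n (K : Poly → Poly → List Poly) → (∀ D E → (D * E == P ^ n) ≡ false → K D E ≡ [])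
    → sumP (concatMap (λ D → concatMap (K D) (cands (P ^ n))) (cands (P ^ n)))
    ≡ ∑[ i < suc n ] sumP (K (P ^ i) (P ^ (n ∸ i)))
  ∑-factorisations n K K≡[] = begin
    sumP (concatMap (λ D → concatMap (K D) L) L)      ≡⟨ sumP-concatMap (λ D → concatMap (K D) L) L ⟩
    sumP (map (λ D → sumP (concatMap (K D) L)) L)    ≡⟨ sumP-map-cong L (λ D → trans (sumP-concatMap (K D) L) (row D)) ⟩
    sumP (map (λ D → ∑[ i < suc n ] F i D) L)        ≡⟨ sumP-map-∑ (suc n) F L ⟩
    ∑[ i < suc n ] sumP (map (F i) L)                 ≡⟨ ∑-cong (suc n) column ⟩
    ∑[ i < suc n ] c i                                ∎
    where
    L = cands (P ^ n)
    T : Poly → Poly → Poly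
    T D E = sumP (K D E)
    T≡0 : ∀ D E → D * E ≢ P ^ n → T D E ≡ 0ₚ
    T≡0 D E DE≢Pⁿ = cong sumP (K≡[] D E (≢⇒==false DE≢Pⁿ))
    c : ℕ → Poly
    c i = T (P ^ i) (P ^ (n ∸ i))
    F : ℕ → Poly → Poly
    F i D = if D == P ^ i then c i else 0ₚ
    row : ∀ D → sumP (map (T D) L) ≡ ∑[ i < suc n ] F i D
    row D with ℕ.anyUpTo? (λ i → D ≟ P ^ i) (suc n)
    ... | yes (j , s≤s j≤n , refl) = begin
      sumP (map (T (P ^ j)) L)
        ≡⟨ sumP-allLen-single (size (P ^ n)) (T (P ^ j)) (P ^ (n ∸ j)) (size-^-mono (ℕ.m∸n≤m n j)) T≡0′ ⟩
      c j
        ≡⟨ sym (if-==-refl (P ^ j) (c j)) ⟩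
      F j (P ^ j)
        ≡⟨ sym (∑-single (suc n) (λ i → F i (P ^ j)) j (s≤s j≤n)
                 (λ i _ i≢j → if-==-≢ (c i) (i≢j ∘ sym ∘ ^-injective))) ⟩
      ∑[ i < suc n ] F i (P ^ j) ∎
      where
      PʲP^n-j≡Pⁿ : P ^ j * P ^ (n ∸ j) ≡ P ^ n
      PʲP^n-j≡Pⁿ = trans (^-+ P j (n ∸ j)) (cong (P ^_) (ℕ.m+[n∸m]≡n j≤n))
      T≡0′ : ∀ E → size E ≤ size (P ^ n) → E ≢ P ^ (n ∸ j) → T (P ^ j) E ≡ 0ₚ
      T≡0′ E _ E≢ = T≡0 (P ^ j) E (λ PʲE≡Pⁿ → E≢ (*-cancelˡ (^-≢0 P≢0 j) (trans PʲE≡Pⁿ (sym PʲP^n-j≡Pⁿ))))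
    ... | no ¬Pⁱ = trans
      (sumP-map-zero L (λ E → T≡0 D E (λ DE≡Pⁿ →
        let (i , i≤n , D≡Pⁱ , _) = *≡^⇒≡^ n D E DE≡Pⁿ in ¬Pⁱ (i , s≤s i≤n , D≡Pⁱ))))
      (sym (∑-zero (suc n) _ (λ i i<1+n → if-==-≢ (c i) (λ D≡Pⁱ → ¬Pⁱ (i , i<1+n , D≡Pⁱ)))))
    column : ∀ i → i < suc n → sumP (map (F i) L) ≡ c i
    column i (s≤s i≤n) = trans
      (sumP-allLen-single (size (P ^ n)) (F i) (P ^ i) (size-^-mono i≤n) (λ D _ D≢Pⁱ → if-==-≢ (c i) D≢Pⁱ))
      (if-==-refl (P ^ i) (c i))

  P∣P^suc : ∀ j → divides? P (P ^ suc j) ≡ true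
  P∣P^suc j = any-∈ (λ Q → P * Q == P ^ suc j) (allLen-complete _ (size-^-mono (ℕ.n≤1+n j))) (==-refl (P ^ suc j))

  coprime?-^ : ∀ j k → coprime? (P ^ suc j) (P ^ suc k) ≡ false
  coprime?-^ j k = all-∈ (λ C → not (divides? C (P ^ suc j) ∧ divides? C (P ^ suc k)) ∨ (C == 1ₚ))
    (allLen-complete _ {P} (subst (λ z → size z ≤ size (P ^ suc j)) (*-identityʳ P) (size-^-mono {1} {suc j} (s≤s z≤n))))
    P-common
    where
    P-common : (not (divides? P (P ^ suc j) ∧ divides? P (P ^ suc k)) ∨ (P == 1ₚ)) ≡ false
    P-common rewrite P∣P^suc j | P∣P^suc k = ≢⇒==false (proj₁ (proj₂ P-irr))

  -- The summands of σ* (P ^ n) and of conv σ* g (P ^ n) exactly as written in Defs.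
  unitaryTerms : ℕ → Poly → Poly → List Poly
  unitaryTerms n D E = if ((D * E) == P ^ n) ∧ coprime? D E then D ∷ [] else []

  σ*-^-suc : ∀ k → σ* (P ^ suc k) ≡ 1ₚ + P ^ suc k
  σ*-^-suc k = begin
    σ* (P ^ suc k)
      ≡⟨ ∑-factorisations (suc k) (unitaryTerms (suc k))
           (λ D E DE≢ → cong (λ b → if b ∧ coprime? D E then D ∷ [] else []) DE≢) ⟩
    sumP (unitaryTerms (suc k) 1ₚ (P ^ suc k)) + ∑< (suc k) t
      ≡⟨ cong₂ _+_ t₀ (∑-single (suc k) t k ℕ.≤-refl t≡0) ⟩
    1ₚ + t k
      ≡⟨ cong (1ₚ +_) tₖ ⟩
    1ₚ + P ^ suc k ∎
    where
    t : ℕ → Poly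
    t i = sumP (unitaryTerms (suc k) (P ^ suc i) (P ^ (k ∸ i)))
    t₀ : sumP (unitaryTerms (suc k) 1ₚ (P ^ suc k)) ≡ 1ₚ
    t₀ rewrite ==-refl (P ^ suc k) | coprime?-1ₚˡ (P ^ suc k) = refl
    tₖ : t k ≡ P ^ suc k
    tₖ rewrite ℕ.n∸n≡0 k | *-identityʳ (P ^ suc k) | ==-refl (P ^ suc k) | coprime?-1ₚʳ (P ^ suc k) = +-identityʳ _
    t≡0 : ∀ i → i < suc k → i ≢ k → t i ≡ 0ₚ
    t≡0 i (s≤s i≤k) i≢k
      rewrite ℕ.+-∸-assoc 1 (ℕ.≤∧≢⇒< i≤k i≢k) | coprime?-^ i (k ∸ suc i)
            | ∧-zeroʳ (P ^ suc i * P ^ suc (k ∸ suc i) == P ^ suc k) = refl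

  convTerms : (Poly → Poly) → ℕ → Poly → Poly → List Poly
  convTerms g n D E = if (D * E) == P ^ n then (σ* D * g E) ∷ [] else []

  conv-^ : ∀ g n → conv σ* g (P ^ n) ≡ ((λ i → σ* (P ^ i)) ⋆ (λ i → g (P ^ i))) n
  conv-^ g n = trans (∑-factorisations n (convTerms g n) (λ D E DE≢ → cong (λ b → if b then σ* D * g E ∷ [] else []) DE≢))
                     (∑-cong (suc n) term)
    where
    term : ∀ i → i < suc n → sumP (convTerms g n (P ^ i) (P ^ (n ∸ i))) ≡ σ* (P ^ i) * g (P ^ (n ∸ i))
    term i (s≤s i≤n) rewrite ^-+ P i (n ∸ i) | ℕ.m+[n∸m]≡n i≤n | ==-refl (P ^ n) = +-identityʳ _

  δ-^ : ∀ n → δ (P ^ n) ≡ δ₀ n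
  δ-^ zero    = refl
  δ-^ (suc m) = if-==-≢ 1ₚ (λ Pⁿ≡1 → ℕ.1+n≢0 (^-injective {suc m} {0} Pⁿ≡1))

-- The inverse series

parity : ∀ m → Σ ℕ λ r → m ≡ 2 *ℕ r ⊎ m ≡ suc (2 *ℕ r)
parity zero = 0 , inj₁ refl
parity (suc m) with parity m
... | r , inj₁ m≡2r   = r , inj₂ (cong suc m≡2r)
... | r , inj₂ m≡2r+1 = suc r , inj₁ (trans (cong suc m≡2r+1) (sym (ℕ.*-suc 2 r)))

module InverseSeries (P : Poly) where

  -- The coefficients of (1 + t)(1 + P t) / (1 + P t²).
  τ : ℕ → Poly
  τ 0                   = 1ₚ
  τ 1                   = 1ₚ + P
  τ 2                   = 0ₚ
  τ (suc (suc (suc n))) = P * τ (suc n)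

  τ-odd     : ∀ r → τ (suc (2 *ℕ r)) ≡ P ^ r * (1ₚ + P)
  τ-odd-suc : ∀ r → τ (suc (suc (suc (2 *ℕ r)))) ≡ P ^ suc r * (1ₚ + P)
  τ-odd zero    = refl
  τ-odd (suc r) rewrite ℕ.*-suc 2 r = τ-odd-suc r
  τ-odd-suc r   = trans (cong (P *_) (τ-odd r)) (sym (*-assoc P (P ^ r) (1ₚ + P)))

  τ-even : ∀ r → τ (suc (suc (2 *ℕ r))) ≡ 0ₚ
  τ-even zero    = refl
  τ-even (suc r) rewrite ℕ.*-suc 2 r = trans (cong (P *_) (τ-even r)) (*-zeroʳ P)

  partialSum : ℕ → Poly
  partialSum = (λ _ → 1ₚ) ⋆ τ

  weightedSum : ℕ → Poly
  weightedSum = (P ^_) ⋆ τ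

  weightedSum-suc : ∀ m → weightedSum (suc m) ≡ τ (suc m) + P * weightedSum m
  weightedSum-suc m = cong (τ (suc m) +_) (trans
    (∑-cong (suc m) (λ i _ → *-assoc P (P ^ i) (τ (m ∸ i))))
    (∑-*ˡ (suc m) P (λ i → P ^ i * τ (m ∸ i))))

  partialSum-closed : ∀ r → partialSum (2 *ℕ r) ≡ P ^ r × partialSum (suc (2 *ℕ r)) ≡ P ^ suc r
  partialSum-closed zero    = refl , solve 1 (λ p → ((Κ 1ₚ ⊕ p) ⊕ Κ 1ₚ) ⊜ (p ⊗ Κ 1ₚ)) refl P
  partialSum-closed (suc r) = subst (λ k → partialSum k ≡ P ^ suc r × partialSum (suc k) ≡ P ^ suc (suc r)) (sym (ℕ.*-suc 2 r))
    (even′ , trans (cong₂ _+_ (τ-odd-suc r) even′)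
                   (solve 2 (λ p x → ((x ⊗ (Κ 1ₚ ⊕ p)) ⊕ x) ⊜ (p ⊗ x)) refl P (P ^ suc r)))
    where
    even′ : partialSum (suc (suc (2 *ℕ r))) ≡ P ^ suc r
    even′ = trans (cong (_+ partialSum (suc (2 *ℕ r))) (τ-even r)) (proj₂ (partialSum-closed r))

  weightedSum-closed : ∀ r → weightedSum (2 *ℕ r) ≡ P ^ r × weightedSum (suc (2 *ℕ r)) ≡ P ^ r
  weightedSum-closed zero    =
    refl , trans (weightedSum-suc 0) (solve 1 (λ p → ((Κ 1ₚ ⊕ p) ⊕ (p ⊗ (Κ 1ₚ ⊕ Κ 0ₚ))) ⊜ Κ 1ₚ) refl P)
  weightedSum-closed (suc r) = subst (λ k → weightedSum k ≡ P ^ suc r × weightedSum (suc k) ≡ P ^ suc r) (sym (ℕ.*-suc 2 r))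
    (even′ , trans (weightedSum-suc (suc (suc (2 *ℕ r)))) (trans (cong₂ (λ u v → u + P * v) (τ-odd-suc r) even′)
               (solve 2 (λ p x → ((x ⊗ (Κ 1ₚ ⊕ p)) ⊕ (p ⊗ x)) ⊜ x) refl P (P ^ suc r))))
    where
    even′ : weightedSum (suc (suc (2 *ℕ r))) ≡ P ^ suc r
    even′ = trans (weightedSum-suc (suc (2 *ℕ r))) (cong₂ (λ u v → u + P * v) (τ-even r) (proj₂ (weightedSum-closed r)))

  weightedSum-suc≡partialSum : ∀ m → weightedSum (suc m) ≡ partialSum m
  weightedSum-suc≡partialSum m with parity m
  ... | r , inj₁ refl = trans (proj₂ (weightedSum-closed r)) (sym (proj₁ (partialSum-closed r)))
  ... | r , inj₂ refl = trans (subst (λ k → weightedSum k ≡ P ^ suc r) (ℕ.*-suc 2 r) (proj₁ (weightedSum-closed (suc r))))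
                              (sym (proj₂ (partialSum-closed r)))

  ⋆-τ≡δ₀ : ∀ s → s 0 ≡ 1ₚ → (∀ i → s (suc i) ≡ 1ₚ + P ^ suc i) → ∀ n → (s ⋆ τ) n ≡ δ₀ n
  ⋆-τ≡δ₀ s s₀≡1 sᵢ≡1+Pⁱ zero    = trans (+-identityʳ _) (trans (*-identityʳ (s 0)) s₀≡1)
  ⋆-τ≡δ₀ s s₀≡1 sᵢ≡1+Pⁱ (suc m) = begin
    s 0 * τ (suc m) + ∑[ i < suc m ] (s (suc i) * τ (m ∸ i))
      ≡⟨ cong₂ (λ c t → c * τ (suc m) + t) s₀≡1 (∑-cong (suc m) (λ i _ →
           trans (cong (_* τ (m ∸ i)) (sᵢ≡1+Pⁱ i)) (*-distribʳ 1ₚ (P ^ suc i) (τ (m ∸ i))))) ⟩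
    τ (suc m) + ∑[ i < suc m ] (τ (m ∸ i) + P ^ suc i * τ (m ∸ i))
      ≡⟨ cong (τ (suc m) +_) (∑-+ (suc m) (λ i → τ (m ∸ i)) (λ i → P ^ suc i * τ (m ∸ i))) ⟩
    τ (suc m) + (partialSum m + ∑[ i < suc m ] (P ^ suc i * τ (m ∸ i)))
      ≡⟨ solve 3 (λ x y z → (x ⊕ (y ⊕ z)) ⊜ (y ⊕ (x ⊕ z))) refl (τ (suc m)) (partialSum m) _ ⟩
    partialSum m + weightedSum (suc m)
      ≡⟨ cong (partialSum m +_) (weightedSum-suc≡partialSum m) ⟩
    partialSum m + partialSum m
      ≡⟨ +-self (partialSum m) ⟩
    0ₚ ∎

lemma4p19 : (g : Poly → Poly) → Multiplicative g
    → (∀ A → A ≢ 0ₚ → conv σ* g A ≡ δ A)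
    → (P : Poly) → Irreducible P
    → (∀ (r : ℕ) → 1 ≤ r → g (P ^ (2 *ℕ r)) ≡ 0ₚ)
      × (∀ (r : ℕ) → g (P ^ (2 *ℕ r +ℕ 1)) ≡ P ^ r * (1ₚ + P))
lemma4p19 g _ σ*⋆g≡δ P P-irr = even , odd
  where
  open PrimePower P-irr
  open InverseSeries P
  s a : ℕ → Poly
  s i = σ* (P ^ i)
  a i = g (P ^ i)
  s⋆a≡δ₀ : ∀ n → (s ⋆ a) n ≡ δ₀ n
  s⋆a≡δ₀ n = trans (sym (conv-^ g n)) (trans (σ*⋆g≡δ (P ^ n) (^-≢0 P≢0 n)) (δ-^ n))
  a≡τ : ∀ n → a n ≡ τ n
  a≡τ = ⋆-cancelˡ {s} refl (λ n → trans (s⋆a≡δ₀ n) (sym (⋆-τ≡δ₀ s refl σ*-^-suc n)))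
  even : ∀ r → 1 ≤ r → g (P ^ (2 *ℕ r)) ≡ 0ₚ
  even (suc r) _ = subst (λ k → g (P ^ k) ≡ 0ₚ) (sym (ℕ.*-suc 2 r))
                         (trans (a≡τ (suc (suc (2 *ℕ r)))) (τ-even r))
  odd : ∀ r → g (P ^ (2 *ℕ r +ℕ 1)) ≡ P ^ r * (1ₚ + P)
  odd r = subst (λ k → g (P ^ k) ≡ P ^ r * (1ₚ + P)) (ℕ.+-comm 1 (2 *ℕ r))
                (trans (a≡τ (suc (2 *ℕ r))) (τ-odd r))
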